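{- For all $m\ge0$ and $n\ge0$, $u_m(n)=2n+1-a_m(2n)$ and $v_m(n)=2n+a_m(2n)$.
   Context: For $n\ge0$ write $b_p(n)=\lfloor n/2^p\rfloor\bmod 2$; $\oplus$ is XOR and $\&$ is bitwise AND. For $m\ge0$, $a_m(n)=\bigoplus_{p\ge0,\ p\,\&\,m=0}b_p(n)$. $v_m(n)$ (resp. $u_m(n)$), $n\ge0$, denotes the $n$-th (indexing from $0$) nonnegative integer, in increasing order, at which $a_m$ equals $0$ (resp. $1$). -}

module Defs where

open import Data.Nat using (ℕ; zero; suc; _+_; _*_; _∸_; _^_; _≡ᵇ_)
open import Data.Nat.DivMod using (_/_; _%_)
open import Data.Nat.Properties using (m^n≢0)
open import Data.Bool using (if_then_else_)
open import Data.Product using (_×_)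
open import Relation.Binary.PropositionalEquality using (_≡_)

bit : ℕ → ℕ → ℕ
bit p n = (_/_ n (2 ^ p) {{m^n≢0 2 p}}) % 2

_⊕_ : ℕ → ℕ → ℕ
x ⊕ y = (x + y) % 2

sumBelow : ℕ → (ℕ → ℕ) → ℕ
sumBelow zero    f = 0
sumBelow (suc k) f = sumBelow k f + f k

xorBelow : ℕ → (ℕ → ℕ) → ℕ
xorBelow zero    f = 0
xorBelow (suc k) f = xorBelow k f ⊕ f k

-- bitwise AND: p & m = Σ_q 2^q b_q(p) b_q(m); bits q ≥ p of p vanish (2^q > p),
-- so the sum over q < p is the full sum.
_&_ : ℕ → ℕ → ℕ
p & m = sumBelow p (λ q → 2 ^ q * bit q p * bit q m)

-- a_m(n) = ⊕_{p ≥ 0, p & m = 0} b_p(n); bits p ≥ n of n vanish (2^p > n),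
-- so the xor over p < n is the full xor.
a : ℕ → ℕ → ℕ
a m n = xorBelow n (λ p → if (p & m) ≡ᵇ 0 then bit p n else 0)

countBelow : ℕ → (ℕ → ℕ) → ℕ → ℕ
countBelow b f k = sumBelow k (λ i → if f i ≡ᵇ b then 1 else 0)

-- x is the n-th (from 0) nonnegative integer, in increasing order, at which f equals b
IsNth : ℕ → (ℕ → ℕ) → ℕ → ℕ → Set
IsNth b f n x = (f x ≡ b) × (countBelow b f x ≡ n)

-- Bit 0 of n is always among the bits xored into a_m(n), because 0 & m = 0, while
-- 2k and 2k + 1 agree in every higher bit. Hence a_m(2k + 1) = 1 − a_m(2k): each block
-- {2k, 2k + 1} contains exactly one zero and one one of a_m. So exactly n zeros and n ones
-- lie below 2n, and the n-th of each is found in the block {2n, 2n + 1}, at 2n when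
-- a_m(2n) has the sought value and at 2n + 1 otherwise.
module Submission where

open import Defs
open import Data.Nat using (ℕ; zero; suc; _+_; _*_; _∸_; _^_; _≡ᵇ_; _<_; _≤_; s≤s; z≤n)
open import Data.Nat.Properties
  using (+-comm; +-assoc; +-identityʳ; +-mono-≤; *-suc; m+n∸n≡m; m^n>0; m^n≢0)
open import Data.Nat.DivMod
  using (_/_; _%_; %-distribˡ-+; m%n%n≡m%n; m<n⇒m%n≡m; %-remove-+ʳ; m%n<n; n/1≡n; m<n⇒m/n≡0;
         m/n/o≡m/[n*o]; +-distrib-/-∣ʳ)
open import Data.Nat.Divisibility using (m∣m*n)
open import Data.Bool using (if_then_else_)
open import Data.Bool.Properties using (if-eta)
open import Data.Product using (_×_; _,_)
open import Relation.Binary.PropositionalEquality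
open ≡-Reasoning

[x%2+y]%2≡[x+y]%2 : ∀ x y → (x % 2 + y) % 2 ≡ (x + y) % 2
[x%2+y]%2≡[x+y]%2 x y = begin
  (x % 2 + y) % 2           ≡⟨ %-distribˡ-+ (x % 2) y 2 ⟩
  (x % 2 % 2 + y % 2) % 2   ≡⟨ cong (λ t → (t + y % 2) % 2) (m%n%n≡m%n x 2) ⟩
  (x % 2 + y % 2) % 2       ≡⟨ %-distribˡ-+ x y 2 ⟨
  (x + y) % 2               ∎

[x⊕1]⊕y≡[x⊕y]⊕1 : ∀ x y → (x ⊕ 1) ⊕ y ≡ (x ⊕ y) ⊕ 1
[x⊕1]⊕y≡[x⊕y]⊕1 x y = begin
  ((x + 1) % 2 + y) % 2   ≡⟨ [x%2+y]%2≡[x+y]%2 (x + 1) y ⟩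
  (x + 1 + y) % 2         ≡⟨ cong (_% 2) x+1+y≡x+y+1 ⟩
  (x + y + 1) % 2         ≡⟨ [x%2+y]%2≡[x+y]%2 (x + y) 1 ⟨
  ((x + y) % 2 + 1) % 2   ∎
  where
  x+1+y≡x+y+1 : x + 1 + y ≡ x + y + 1
  x+1+y≡x+y+1 = trans (+-assoc x 1 y) (trans (cong (x +_) (+-comm 1 y)) (sym (+-assoc x y 1)))

xorBelow<2 : ∀ k f → xorBelow k f < 2
xorBelow<2 zero    f = s≤s z≤n
xorBelow<2 (suc k) f = m%n<n (xorBelow k f + f k) 2

xorBelow-extend-by-0 : ∀ {k f} → f k ≡ 0 → xorBelow (suc k) f ≡ xorBelow k f
xorBelow-extend-by-0 {k} {f} fk≡0 = begin
  (xorBelow k f + f k) % 2   ≡⟨ cong (λ t → (xorBelow k f + t) % 2) fk≡0 ⟩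
  (xorBelow k f + 0) % 2     ≡⟨ cong (_% 2) (+-identityʳ (xorBelow k f)) ⟩
  xorBelow k f % 2           ≡⟨ m<n⇒m%n≡m (xorBelow<2 k f) ⟩
  xorBelow k f               ∎

xorBelow-flip-head : ∀ j {f h : ℕ → ℕ} → f 0 ≡ 1 → h 0 ≡ 0 → (∀ p → f (suc p) ≡ h (suc p)) →
  xorBelow (suc j) f ≡ xorBelow (suc j) h ⊕ 1
xorBelow-flip-head zero    f0≡1 h0≡0 _ rewrite f0≡1 | h0≡0 = refl
xorBelow-flip-head (suc j) {f} {h} f0≡1 h0≡0 tails-agree = begin
  xorBelow (suc j) f ⊕ f (suc j)          ≡⟨ cong₂ _⊕_ (xorBelow-flip-head j f0≡1 h0≡0 tails-agree)
                                                       (tails-agree j) ⟩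
  (xorBelow (suc j) h ⊕ 1) ⊕ h (suc j)    ≡⟨ [x⊕1]⊕y≡[x⊕y]⊕1 (xorBelow (suc j) h) (h (suc j)) ⟩
  (xorBelow (suc j) h ⊕ h (suc j)) ⊕ 1    ∎

n<2^n : ∀ n → n < 2 ^ n
n<2^n zero    = s≤s z≤n
n<2^n (suc n) = subst (suc (suc n) ≤_) (cong (2 ^ n +_) (sym (+-identityʳ (2 ^ n))))
                      (+-mono-≤ (m^n>0 2 n) (n<2^n n))

bit-zero : ∀ n → bit 0 n ≡ n % 2
bit-zero n = cong (_% 2) (n/1≡n n)

bit-suc : ∀ p n → bit (suc p) n ≡ bit p (n / 2)
bit-suc p n = cong (_% 2) (sym (m/n/o≡m/[n*o] n 2 (2 ^ p) {{_}} {{m^n≢0 2 p}} {{m^n≢0 2 (suc p)}}))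

bit-vanishes : ∀ {p n} → n < 2 ^ p → bit p n ≡ 0
bit-vanishes {p} n<2^p = cong (_% 2) (m<n⇒m/n≡0 {{m^n≢0 2 p}} n<2^p)

[1+2k]/2≡2k/2 : ∀ k → suc (2 * k) / 2 ≡ 2 * k / 2
[1+2k]/2≡2k/2 k = +-distrib-/-∣ʳ 1 (m∣m*n {2} k)

bit-suc-odd : ∀ p k → bit (suc p) (suc (2 * k)) ≡ bit (suc p) (2 * k)
bit-suc-odd p k = begin
  bit (suc p) (suc (2 * k))   ≡⟨ bit-suc p (suc (2 * k)) ⟩
  bit p (suc (2 * k) / 2)     ≡⟨ cong (bit p) ([1+2k]/2≡2k/2 k) ⟩
  bit p (2 * k / 2)           ≡⟨ bit-suc p (2 * k) ⟨
  bit (suc p) (2 * k)         ∎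

aTerm : ℕ → ℕ → ℕ → ℕ
aTerm m n p = if (p & m) ≡ᵇ 0 then bit p n else 0

if-then-0 : ∀ c {x} → x ≡ 0 → (if c then x else 0) ≡ 0
if-then-0 c x≡0 = trans (cong (λ t → if c then t else 0) x≡0) (if-eta c)

aTerm-self : ∀ m n → aTerm m n n ≡ 0
aTerm-self m n = if-then-0 ((n & m) ≡ᵇ 0) (bit-vanishes {n} (n<2^n n))

a-odd : ∀ m k → a m (suc (2 * k)) ≡ a m (2 * k) ⊕ 1
a-odd m k = begin
  a m (suc (2 * k))                                ≡⟨⟩
  xorBelow (suc (2 * k)) (aTerm m (suc (2 * k)))  ≡⟨ xorBelow-flip-head (2 * k) odd-head even-head tails-agree ⟩
  xorBelow (suc (2 * k)) (aTerm m (2 * k)) ⊕ 1     ≡⟨ cong (_⊕ 1) (xorBelow-extend-by-0 {2 * k} {aTerm m (2 * k)}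
                                                                                    (aTerm-self m (2 * k))) ⟩
  a m (2 * k) ⊕ 1                                  ∎
  where
  odd-head : aTerm m (suc (2 * k)) 0 ≡ 1
  odd-head = trans (bit-zero (suc (2 * k))) (%-remove-+ʳ 1 (m∣m*n {2} k))

  even-head : aTerm m (2 * k) 0 ≡ 0
  even-head = trans (bit-zero (2 * k)) (%-remove-+ʳ 0 (m∣m*n {2} k))

  tails-agree : ∀ p → aTerm m (suc (2 * k)) (suc p) ≡ aTerm m (2 * k) (suc p)
  tails-agree p = cong (λ t → if (suc p & m) ≡ᵇ 0 then t else 0) (bit-suc-odd p k)

a<2 : ∀ m n → a m n < 2
a<2 m n = xorBelow<2 n (aTerm m n)

indicator : ℕ → ℕ → ℕ
indicator b x = if x ≡ᵇ b then 1 else 0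

indicator-complement : ∀ {b x} → b ≤ 1 → x < 2 → indicator b x + indicator b (x ⊕ 1) ≡ 1
indicator-complement z≤n       (s≤s z≤n)       = refl
indicator-complement z≤n       (s≤s (s≤s z≤n)) = refl
indicator-complement (s≤s z≤n) (s≤s z≤n)       = refl
indicator-complement (s≤s z≤n) (s≤s (s≤s z≤n)) = refl

module _ {f : ℕ → ℕ} (f<2 : ∀ x → f x < 2) (f-odd : ∀ k → f (suc (2 * k)) ≡ f (2 * k) ⊕ 1) where

  countBelow-double : ∀ {b} → b ≤ 1 → ∀ n → countBelow b f (2 * n) ≡ n
  countBelow-double b≤1 zero    = refl
  countBelow-double {b} b≤1 (suc n) = begin
    countBelow b f (2 * suc n)                                 ≡⟨ cong (countBelow b f) (*-suc 2 n) ⟩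
    countBelow b f (2 * n) + indicator b (f (2 * n))
                           + indicator b (f (suc (2 * n)))     ≡⟨ +-assoc (countBelow b f (2 * n)) _ _ ⟩
    countBelow b f (2 * n) + (indicator b (f (2 * n))
                           + indicator b (f (suc (2 * n))))    ≡⟨ cong₂ _+_ (countBelow-double b≤1 n) block ⟩
    n + 1                                                      ≡⟨ +-comm n 1 ⟩
    suc n                                                      ∎
    where
    block : indicator b (f (2 * n)) + indicator b (f (suc (2 * n))) ≡ 1
    block rewrite f-odd n = indicator-complement b≤1 (f<2 (2 * n))

  isNth-even : ∀ {b} n → b ≤ 1 → f (2 * n) ≡ b → IsNth b f n (2 * n)
  isNth-even n b≤1 f2n≡b = f2n≡b , countBelow-double b≤1 n

  isNth-odd : ∀ {b} n → b ≤ 1 → indicator b (f (2 * n)) ≡ 0 → f (suc (2 * n)) ≡ b →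
    IsNth b f n (suc (2 * n))
  isNth-odd {b} n b≤1 f2n≢b f2n+1≡b = f2n+1≡b , (begin
    countBelow b f (2 * n) + indicator b (f (2 * n))   ≡⟨ cong₂ _+_ (countBelow-double b≤1 n) f2n≢b ⟩
    n + 0                                              ≡⟨ +-identityʳ n ⟩
    n                                                  ∎)

  isNth-alternating : ∀ n →
    IsNth 1 f n (2 * n + 1 ∸ f (2 * n)) × IsNth 0 f n (2 * n + f (2 * n))
  isNth-alternating n with f (2 * n) in f2n | f<2 (2 * n) | f-odd n
  ... | 0 | _ | f2n+1≡1 =
    subst (IsNth 1 f n) (sym (+-comm (2 * n) 1)) (isNth-odd n (s≤s z≤n) (cong (indicator 1) f2n) f2n+1≡1)
    , subst (IsNth 0 f n) (sym (+-identityʳ (2 * n))) (isNth-even n z≤n f2n)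
  ... | 1 | _ | f2n+1≡0 =
    subst (IsNth 1 f n) (sym (m+n∸n≡m (2 * n) 1)) (isNth-even n (s≤s z≤n) f2n)
    , subst (IsNth 0 f n) (sym (+-comm (2 * n) 1)) (isNth-odd n z≤n (cong (indicator 0) f2n) f2n+1≡0)
  ... | suc (suc _) | s≤s (s≤s ()) | _

lemma12 : (m n : ℕ) →
    IsNth 1 (a m) n (2 * n + 1 ∸ a m (2 * n))
      × IsNth 0 (a m) n (2 * n + a m (2 * n))
lemma12 m = isNth-alternating (a<2 m) (a-odd m)
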